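{- Let $k\geq 3$ and let $G=(V,E)$ be a finite simple graph with chromatic number $k+1$ and girth $g$, whose vertices are labelled by $[n]$ so that every index-increasing path has length at most $k$. Let $d\geq 0$ be an integer with $2d<\frac{g}{2k}-1$ and let $\boldsymbol{\alpha}\in\mathbb{Z}_k^V$ with $|\boldsymbol{\alpha}|\leq d$. Then the essential graph of $x^{\boldsymbol{\alpha}}$ is a forest.
   Context: Index-increasing path: $u_1\cdots u_t$ with $u_1<\dots<u_t$; length = number of edges. For an edge $\{u,v\}$ with $u<v$, $u$ is a parent of $v$ and $v$ a child of $u$; $v$ is a descendant of $u$ if there is an index-increasing path from $u$ to $v$. For $\boldsymbol{\alpha}\in\mathbb{Z}_k^V$ (entries in $\{0,\dots,k-1\}$), $|\boldsymbol{\alpha}|=\sum_w\boldsymbol{\alpha}_w$ and $\supp(\boldsymbol{\alpha})=\{w:\boldsymbol{\alpha}_w>0\}$. The descendant graph of $x^{\boldsymbol{\alpha}}$ is the subgraph of $G$ induced by $\supp(\boldsymbol{\alpha})$ and all descendants of its vertices. The essential graph $H_{\boldsymbol{\alpha}}=(U_{\boldsymbol{\alpha}},F_{\boldsymbol{\alpha}})$ of $x^{\boldsymbol{\alpha}}$ is built as follows: start with $H_{\boldsymbol{\alpha}}$ equal to the descendant graph of $x^{\boldsymbol{\alpha}}$; whenever two vertices $u,v\in U_{\boldsymbol{\alpha}}$ in different connected components of $H_{\boldsymbol{\alpha}}$ have parents $u^\ast,v^\ast$ in $G$ with $u^\ast=v^\ast$ or $\{u^\ast,v^\ast\}\in E$,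 add $u^\ast,v^\ast$ and all their descendants to $U_{\boldsymbol{\alpha}}$ and replace $H_{\boldsymbol{\alpha}}$ by the subgraph of $G$ induced by the new $U_{\boldsymbol{\alpha}}$; repeat until no two connected components of $H_{\boldsymbol{\alpha}}$ have common or adjacent parents. -}

module Defs where

open import Data.Nat using (ℕ; zero; suc; _+_; _*_; _≤_; _<_)
open import Data.Fin using (Fin; toℕ; inject₁)
open import Data.Fin.Properties using ()
open import Data.Vec using (tabulate)
open import Data.Vec using () renaming (sum to vsum)
open import Data.Product using (Σ; ∃; ∃-syntax; _×_; _,_)
open import Data.Sum using (_⊎_)
open import Data.Empty using (⊥)
open import Data.Unit using (⊤)
open import Relation.Nullary using (¬_; Dec)
open import Relation.Binary.PropositionalEquality using (_≡_; _≢_)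
open import Relation.Binary.Construct.Closure.ReflexiveTransitive using (Star)
open import Function.Definitions using (Injective)

record Graph (n : ℕ) : Set₁ where
  field
    Adj        : Fin n → Fin n → Set
    adj-sym    : ∀ {u v} → Adj u v → Adj v u
    adj-irrefl : ∀ {u} → ¬ Adj u u
    adj-dec    : ∀ u v → Dec (Adj u v)

open Graph public

VSet : ℕ → Set₁
VSet n = Fin n → Set

Full : ∀ {n} → VSet n
Full _ = ⊤

ProperColouring : ∀ {n} → Graph n → (m : ℕ) → (Fin n → Fin m) → Set
ProperColouring G m c = ∀ {u v} → Adj G u v → c u ≢ c v

Colourable : ∀ {n} → Graph n → ℕ → Set
Colourable {n} G m = Σ (Fin n → Fin m) (ProperColouring G m)

ChromaticNumber : ∀ {n} → Graph n → ℕ → Set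
ChromaticNumber G χ = Colourable G χ × (∀ m → m < χ → ¬ Colourable G m)

CycSucc : ∀ {ℓ} → Fin ℓ → Fin ℓ → Set
CycSucc {ℓ} i j = (suc (toℕ i) ≡ toℕ j) ⊎ (suc (toℕ i) ≡ ℓ × toℕ j ≡ 0)

CycleIn : ∀ {n} → Graph n → VSet n → ℕ → Set
CycleIn {n} G U ℓ =
  3 ≤ ℓ × Σ (Fin ℓ → Fin n) λ f →
    Injective _≡_ _≡_ f × (∀ i → U (f i)) × (∀ i j → CycSucc i j → Adj G (f i) (f j))

Cycle : ∀ {n} → Graph n → ℕ → Set
Cycle G ℓ = CycleIn G Full ℓ

Girth : ∀ {n} → Graph n → ℕ → Set
Girth G g = Cycle G g × (∀ ℓ → ℓ < g → ¬ Cycle G ℓ)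

IncPath : ∀ {n} → Graph n → (ℓ : ℕ) → (Fin (suc ℓ) → Fin n) → Set
IncPath G ℓ f = ∀ (i : Fin ℓ) →
  (toℕ (f (inject₁ i)) < toℕ (f (Fin.suc i))) × Adj G (f (inject₁ i)) (f (Fin.suc i))

PathsBounded : ∀ {n} → Graph n → ℕ → Set
PathsBounded G k = ∀ ℓ f → IncPath G ℓ f → ℓ ≤ k

Parent : ∀ {n} → Graph n → Fin n → Fin n → Set
Parent G p v = Adj G p v × toℕ p < toℕ v

Desc : ∀ {n} → Graph n → Fin n → Fin n → Set
Desc {n} G u v = Σ ℕ λ ℓ → Σ (Fin (suc ℓ) → Fin n) λ f →
  IncPath G ℓ f × f Fin.zero ≡ u × f (Data.Fin.fromℕ ℓ) ≡ v

∣_∣ₘ : ∀ {n k} → (Fin n → Fin k) → ℕ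
∣ α ∣ₘ = vsum (tabulate (λ w → toℕ (α w)))

Supp : ∀ {n k} → (Fin n → Fin k) → VSet n
Supp α w = 0 < toℕ (α w)

DescSet : ∀ {n k} → Graph n → (Fin n → Fin k) → VSet n
DescSet G α w = ∃[ s ] (Supp α s × Desc G s w)

InducedAdj : ∀ {n} → Graph n → VSet n → Fin n → Fin n → Set
InducedAdj G U a b = U a × U b × Adj G a b

ConnectedIn : ∀ {n} → Graph n → VSet n → Fin n → Fin n → Set
ConnectedIn G U = Star (InducedAdj G U)

MergeWitness : ∀ {n} → Graph n → VSet n → Fin n → Fin n → Set
MergeWitness G U u* v* = ∃[ u ] ∃[ v ]
  (U u × U v × ¬ ConnectedIn G U u v × Parent G u* u × Parent G v* v
   × (u* ≡ v* ⊎ Adj G u* v*))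

-- Sets U_α reachable by running the essential-graph construction
-- (any order of steps).
data EssRun {n k} (G : Graph n) (α : Fin n → Fin k) : VSet n → Set₁ where
  start : EssRun G α (DescSet G α)
  step  : ∀ {U} u* v* → EssRun G α U → MergeWitness G U u* v* →
          EssRun G α (λ w → U w ⊎ Desc G u* w ⊎ Desc G v* w)

Terminal : ∀ {n} → Graph n → VSet n → Set
Terminal G U = ∀ u* v* → ¬ MergeWitness G U u* v*

IsEssential : ∀ {n k} → Graph n → (Fin n → Fin k) → VSet n → Set₁
IsEssential G α U = EssRun G α U × Terminal G U

IsForest : ∀ {n} → Graph n → VSet n → Set
IsForest G U = ∀ ℓ → ¬ CycleIn G U ℓ

-- Every set produced by the essential-graph construction is covered by the descendants of a list
-- of roots, all of whose descendants lie in the set: initially the support of α, and each merge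
-- step adds one root (the lower of u*, v*) while fusing two classes of roots that are connected in
-- the induced subgraph. Since |roots| + #classes never grows, there are at most 2d roots. Now take
-- a shortest cycle of G[U]; by the girth its length ℓ exceeds 2k(2d+1). Monotone stretches of the
-- cycle are index-increasing paths, hence of length at most k, so every position is followed
-- within 2k steps by a valley bottom (a local minimum), which is reached from some root by an
-- index-increasing path of length at most k. By pigeonhole two distinct valley bottoms are reached
-- from the same root. The shorter arc between them (at most ℓ/2) and the two paths from the root
-- form a closed walk of length < ℓ that uses the edge from the higher bottom to its neighbour off
-- the arc exactly once, so it contains a shorter cycle: a contradiction.

module Submission where

open import Defs
open import Data.Nat using (ℕ; zero; suc; _+_; _*_; _≤_; _<_; z≤n; s≤s; z<s; _<?_; _≤?_; _%_; _/_)
open import Data.Nat.Properties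
open import Data.Nat.DivMod
open import Data.Nat.Induction using (<-rec)
open import Data.Nat.Tactic.RingSolver using (solve-∀)
open import Data.Fin as Fin using (Fin; toℕ)
import Data.Fin.Properties as Finₚ
open import Data.Fin.Properties
  using (toℕ-injective; toℕ<n; toℕ-fromℕ; toℕ-inject₁; toℕ-fromℕ<; punchOut-injective; ¬Fin0)
open import Data.List as List using (List; []; _∷_; length; lookup)
open import Data.List.Properties using (length-map)
open import Data.List.Relation.Unary.Any as Any using (here; there)
open import Data.List.Relation.Unary.Any.Properties using (lookup-index)
open import Data.List.Membership.Propositional using (_∈_)
open import Data.List.Membership.Propositional.Properties using (∈-map⁺; ∈-map⁻; ∈-lookup)
open import Data.Product using (Σ; ∃-syntax; _×_; _,_; proj₁; proj₂)
open import Data.Sum using (_⊎_; inj₁; inj₂; [_,_]; swap)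
open import Data.Empty using (⊥-elim)
open import Data.Unit using (⊤; tt)
open import Function using (_∘_)
open import Relation.Nullary using (¬_; Dec; yes; no)
open import Relation.Binary.Definitions using (DecidableEquality; tri<; tri≈; tri>)
open import Relation.Binary.PropositionalEquality hiding ([_])
open import Relation.Binary.Construct.Closure.ReflexiveTransitive as Star using (ε; _◅_; _◅◅_)

infixr 5 _∷_

data Walk {A : Set} (R : A → A → Set) : ℕ → A → A → Set where
  []  : ∀ {a} → Walk R 0 a a
  _∷_ : ∀ {m a b c} → R a b → Walk R m b c → Walk R (suc m) a c

module _ {A : Set} {R : A → A → Set} where

  infixr 5 _++_
  _++_ : ∀ {m m' a b c} → Walk R m a b → Walk R m' b c → Walk R (m + m') a c
  []      ++ q = q
  (e ∷ p) ++ q = e ∷ (p ++ q)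

  map : ∀ {S : A → A → Set} → (∀ {a b} → R a b → S a b) →
        ∀ {m a b} → Walk R m a b → Walk S m a b
  map f []      = []
  map f (e ∷ p) = f e ∷ map f p

  vertex : ∀ {m a b} → Walk R m a b → ℕ → A
  vertex {a = a} []      _       = a
  vertex {a = a} (e ∷ p) zero    = a
  vertex         (e ∷ p) (suc i) = vertex p i

  vertex-first : ∀ {m a b} (p : Walk R m a b) → vertex p 0 ≡ a
  vertex-first []      = refl
  vertex-first (e ∷ p) = refl

  vertex-last : ∀ {m a b} (p : Walk R m a b) → vertex p m ≡ b
  vertex-last []      = refl
  vertex-last (e ∷ p) = vertex-last p

  vertex-step : ∀ {m a b} (p : Walk R m a b) i → i < m → R (vertex p i) (vertex p (suc i))
  vertex-step (e ∷ p) zero    _         = subst (R _) (sym (vertex-first p)) e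
  vertex-step (e ∷ p) (suc i) (s≤s i<m) = vertex-step p i i<m

  _∈ʷ_ : ∀ {m a b} → A → Walk R m a b → Set
  _∈ʷ_ {a = a} x []      = x ≡ a
  _∈ʷ_ {a = a} x (e ∷ p) = x ≡ a ⊎ x ∈ʷ p

  Simple : ∀ {m a b} → Walk R m a b → Set
  Simple []              = ⊤
  Simple {a = a} (e ∷ p) = ¬ a ∈ʷ p × Simple p

  vertex-∈ʷ : ∀ {m a b} (p : Walk R m a b) i → i ≤ m → vertex p i ∈ʷ p
  vertex-∈ʷ []      zero    _         = refl
  vertex-∈ʷ (e ∷ p) zero    _         = inj₁ refl
  vertex-∈ʷ (e ∷ p) (suc i) (s≤s i≤m) = inj₂ (vertex-∈ʷ p i i≤m)

  vertex-injective : ∀ {m a b} (p : Walk R m a b) → Simple p →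
                     ∀ {i j} → i ≤ m → j ≤ m → vertex p i ≡ vertex p j → i ≡ j
  vertex-injective []      _        {zero}  {zero}  _         _         _  = refl
  vertex-injective (e ∷ p) _        {zero}  {zero}  _         _         _  = refl
  vertex-injective (e ∷ p) (a∉p , _) {zero}  {suc j} _         (s≤s j≤m) eq =
    ⊥-elim (a∉p (subst (_∈ʷ p) (sym eq) (vertex-∈ʷ p j j≤m)))
  vertex-injective (e ∷ p) (a∉p , _) {suc i} {zero}  (s≤s i≤m) _         eq =
    ⊥-elim (a∉p (subst (_∈ʷ p) eq (vertex-∈ʷ p i i≤m)))
  vertex-injective (e ∷ p) (_ , sp) {suc i} {suc j} (s≤s i≤m) (s≤s j≤m) eq =
    cong suc (vertex-injective p sp i≤m j≤m eq)

reverse : ∀ {A : Set} {R S : A → A → Set} → (∀ {a b} → R a b → S b a) →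
          ∀ {m a b} → Walk R m a b → Walk S m b a
reverse flip []                        = []
reverse {S = S} flip {suc m} {a} {b} (e ∷ p) =
  subst (λ m' → Walk S m' b a) (+-comm m 1) (reverse flip p ++ (flip e ∷ []))

module LoopErasure {A : Set} (_≟_ : DecidableEquality A) {R : A → A → Set} where

  _∈ʷ?_ : ∀ {m a b} x (p : Walk R m a b) → Dec (x ∈ʷ p)
  _∈ʷ?_ {a = a} x []      = x ≟ a
  _∈ʷ?_ {a = a} x (e ∷ p) with x ≟ a | x ∈ʷ? p
  ... | yes x≡a | _       = yes (inj₁ x≡a)
  ... | no _    | yes x∈p = yes (inj₂ x∈p)
  ... | no x≢a  | no x∉p  = no [ x≢a , x∉p ]

  suffix : ∀ {m a b x} (p : Walk R m a b) → Simple p → x ∈ʷ p →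
           ∃[ m' ] m' ≤ m × Σ (Walk R m' x b) Simple
  suffix []      _        refl         = 0 , z≤n , [] , tt
  suffix (e ∷ p) sp       (inj₁ refl)  = _ , ≤-refl , e ∷ p , sp
  suffix (e ∷ p) (_ , sp) (inj₂ x∈p)  with suffix p sp x∈p
  ... | m' , m'≤m , q , sq = m' , m≤n⇒m≤1+n m'≤m , q , sq

  erase : ∀ {m a b} → Walk R m a b → ∃[ m' ] m' ≤ m × Σ (Walk R m' a b) Simple
  erase []      = 0 , z≤n , [] , tt
  erase {a = a} (e ∷ p) with erase p
  ... | m' , m'≤m , q , sq with a ∈ʷ? q
  ...   | yes a∈q = let m'' , m''≤m' , r , sr = suffix q sq a∈q
                    in m'' , m≤n⇒m≤1+n (≤-trans m''≤m' m'≤m) , r , sr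
  ...   | no a∉q  = suc m' , s≤s m'≤m , e ∷ q , a∉q , sq

module _ {n : ℕ} (G : Graph n) where

  open LoopErasure (Fin._≟_ {n})

  SameEdge : Fin n → Fin n → Fin n → Fin n → Set
  SameEdge w c p q = (p ≡ w × q ≡ c) ⊎ (p ≡ c × q ≡ w)

  AdjExcept : VSet n → Fin n → Fin n → Fin n → Fin n → Set
  AdjExcept U w c p q = InducedAdj G U p q × ¬ SameEdge w c p q

  simple-walk⇒cycle : ∀ {S : Fin n → Fin n → Set} {U w c m} →
                      (∀ {p q} → S p q → InducedAdj G U p q) → Adj G w c → 2 ≤ m →
                      (p : Walk S m c w) → Simple p → CycleIn G U (suc m)
  simple-walk⇒cycle {U = U} {w} {c} {m} adj w~c 2≤m p simple =
    s≤s 2≤m , f , f-injective , (λ i → vertex-in (toℕ i) (bound i)) , f-adj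
    where
      f : Fin (suc m) → Fin n
      f i = vertex p (toℕ i)

      bound : (i : Fin (suc m)) → toℕ i ≤ m
      bound i = ≤-pred (toℕ<n i)

      edge : ∀ i → i < m → InducedAdj G U (vertex p i) (vertex p (suc i))
      edge i i<m = adj (vertex-step p i i<m)

      vertex-in : ∀ i → i ≤ m → U (vertex p i)
      vertex-in zero    _     = proj₁ (edge 0 (≤-trans (s≤s z≤n) 2≤m))
      vertex-in (suc i) 1+i≤m = proj₁ (proj₂ (edge i 1+i≤m))

      f-injective : ∀ {i j} → f i ≡ f j → i ≡ j
      f-injective {i} {j} eq = toℕ-injective (vertex-injective p simple (bound i) (bound j) eq)

      f-adj : ∀ i j → CycSucc i j → Adj G (f i) (f j)
      f-adj i j (inj₁ 1+i≡j) =
        subst (λ z → Adj G (f i) (vertex p z)) 1+i≡j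
          (proj₂ (proj₂ (edge (toℕ i) (subst (_≤ m) (sym 1+i≡j) (bound j)))))
      f-adj i j (inj₂ (1+i≡1+m , j≡0)) =
        subst₂ (Adj G)
          (sym (trans (cong (vertex p) (suc-injective 1+i≡1+m)) (vertex-last p)))
          (sym (trans (cong (vertex p) j≡0) (vertex-first p)))
          w~c

  closed-walk⇒cycle : ∀ {U w c m} → Adj G w c → Walk (AdjExcept U w c) m c w →
                      ∃[ m' ] m' ≤ m × CycleIn G U (suc m')
  closed-walk⇒cycle {U} {w} {c} w~c p with erase p
  ... | _ , m'≤m , []                , _      = ⊥-elim (adj-irrefl G w~c)
  ... | _ , m'≤m , (_ , ¬wc) ∷ []    , _      = ⊥-elim (¬wc (inj₂ (refl , refl)))
  ... | _ , m'≤m , q@(_ ∷ _ ∷ _)     , simple =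
    _ , m'≤m , simple-walk⇒cycle proj₁ w~c (s≤s (s≤s z≤n)) q simple

  Chain : ℕ → Fin n → Fin n → Set
  Chain = Walk (Parent G)

  chain-≤ : ∀ {m a b} → Chain m a b → toℕ a ≤ toℕ b
  chain-≤ []            = ≤-refl
  chain-≤ ((_ , a<b) ∷ p) = ≤-trans (<⇒≤ a<b) (chain-≤ p)

  chain⇒IncPath : ∀ {m a b} (p : Chain m a b) → IncPath G m (vertex p ∘ toℕ)
  chain⇒IncPath p i with vertex-step p (toℕ i) (toℕ<n i)
  ... | p~q , p<q rewrite toℕ-inject₁ i = p<q , p~q

  chain⇒Desc : ∀ {m a b} → Chain m a b → Desc G a b
  chain⇒Desc {m} p =
    m , vertex p ∘ toℕ , chain⇒IncPath p , vertex-first p ,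
    trans (cong (vertex p) (toℕ-fromℕ m)) (vertex-last p)

  Desc⇒chain : ∀ {a b} → Desc G a b → ∃[ m ] Chain m a b
  Desc⇒chain (ℓ , f , inc , refl , refl) = ℓ , chain ℓ f inc
    where
      chain : ∀ ℓ (f : Fin (suc ℓ) → Fin n) → IncPath G ℓ f → Chain ℓ (f Fin.zero) (f (Fin.fromℕ ℓ))
      chain zero    f inc = []
      chain (suc ℓ) f inc =
        (proj₂ (inc Fin.zero) , proj₁ (inc Fin.zero)) ∷ chain ℓ (f ∘ Fin.suc) (inc ∘ Fin.suc)

  chain-length≤ : ∀ {k} → PathsBounded G k → ∀ {m a b} → Chain m a b → m ≤ k
  chain-length≤ bounded {m} p = bounded m (vertex p ∘ toℕ) (chain⇒IncPath p)

module Fuse {c : ℕ} {a b : Fin (suc c)} (a≢b : a ≢ b) where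

  InPair : Fin (suc c) → Set
  InPair x = x ≡ a ⊎ x ≡ b

  private
    redirect : Fin (suc c) → Fin (suc c)
    redirect x with x Fin.≟ b
    ... | yes _ = a
    ... | no  _ = x

    b≢redirect : ∀ x → b ≢ redirect x
    b≢redirect x with x Fin.≟ b
    ... | yes _   = a≢b ∘ sym
    ... | no  x≢b = x≢b ∘ sym

    redirect-≡ : ∀ {x y} → redirect x ≡ redirect y → x ≡ y ⊎ (InPair x × InPair y)
    redirect-≡ {x} {y} eq with x Fin.≟ b | y Fin.≟ b
    ... | yes x≡b | yes y≡b = inj₂ (inj₂ x≡b , inj₂ y≡b)
    ... | yes x≡b | no  _   = inj₂ (inj₂ x≡b , inj₁ (sym eq))
    ... | no  _   | yes y≡b = inj₂ (inj₁ eq , inj₂ y≡b)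
    ... | no  _   | no  _   = inj₁ eq

  fuse : Fin (suc c) → Fin c
  fuse x = Fin.punchOut (b≢redirect x)

  fuse-≡ : ∀ {x y} → fuse x ≡ fuse y → x ≡ y ⊎ (InPair x × InPair y)
  fuse-≡ {x} {y} eq = redirect-≡ (punchOut-injective (b≢redirect x) (b≢redirect y) eq)

support : ∀ {n k} → (Fin n → Fin k) → List (Fin n)
support {zero}  α = []
support {suc n} α with 0 <? toℕ (α Fin.zero)
... | yes _ = Fin.zero ∷ List.map Fin.suc (support (α ∘ Fin.suc))
... | no  _ = List.map Fin.suc (support (α ∘ Fin.suc))

∈-support⁺ : ∀ {n k} (α : Fin n → Fin k) {s} → Supp α s → s ∈ support α
∈-support⁺ {suc n} α {s} s∈supp with 0 <? toℕ (α Fin.zero) | s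
... | yes _   | Fin.zero  = here refl
... | yes _   | Fin.suc s = there (∈-map⁺ Fin.suc (∈-support⁺ (α ∘ Fin.suc) s∈supp))
... | no  α₀≯0 | Fin.zero  = ⊥-elim (α₀≯0 s∈supp)
... | no  _   | Fin.suc s = ∈-map⁺ Fin.suc (∈-support⁺ (α ∘ Fin.suc) s∈supp)

suc-∈-map-suc⁻ : ∀ {n} {t : Fin n} {xs} → Fin.suc t ∈ List.map Fin.suc xs → t ∈ xs
suc-∈-map-suc⁻ t∈ with ∈-map⁻ Fin.suc t∈
... | _ , x∈ , refl = x∈

zero∉map-suc : ∀ {n} {xs : List (Fin n)} → ¬ Fin.zero ∈ List.map Fin.suc xs
zero∉map-suc z∈ with ∈-map⁻ Fin.suc z∈
... | _ , _ , ()

∈-support⁻ : ∀ {n k} (α : Fin n → Fin k) {s} → s ∈ support α → Supp α s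
∈-support⁻ {suc n} α {s} s∈ with 0 <? toℕ (α Fin.zero) | s | s∈
... | yes α₀>0 | Fin.zero  | _        = α₀>0
... | yes _    | Fin.suc t | there t∈ = ∈-support⁻ (α ∘ Fin.suc) (suc-∈-map-suc⁻ t∈)
... | no  _    | Fin.zero  | z∈       = ⊥-elim (zero∉map-suc z∈)
... | no  _    | Fin.suc t | t∈       = ∈-support⁻ (α ∘ Fin.suc) (suc-∈-map-suc⁻ t∈)

length-map-suc-support≤ : ∀ {n k} (α : Fin (suc n) → Fin k) →
                          length (List.map Fin.suc (support (α ∘ Fin.suc))) ≤ ∣ α ∘ Fin.suc ∣ₘ

length-support≤ : ∀ {n k} (α : Fin n → Fin k) → length (support α) ≤ ∣ α ∣ₘ
length-support≤ {zero}  α = z≤n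
length-support≤ {suc n} α with 0 <? toℕ (α Fin.zero)
... | yes α₀>0 = +-mono-≤ α₀>0 (length-map-suc-support≤ α)
... | no  _    = ≤-trans (length-map-suc-support≤ α) (m≤n+m _ (toℕ (α Fin.zero)))

length-map-suc-support≤ α =
  ≤-trans (≤-reflexive (length-map Fin.suc (support (α ∘ Fin.suc)))) (length-support≤ (α ∘ Fin.suc))

module _ {n : ℕ} (G : Graph n) where

  DescendantsIn : VSet n → Fin n → Set
  DescendantsIn U r = ∀ {m z} → Chain G m r z → U z

  connected-sym : ∀ {V a b} → ConnectedIn G V a b → ConnectedIn G V b a
  connected-sym = Star.reverse (λ (Va , Vb , a~b) → Vb , Va , adj-sym G a~b)

  connected-mono : ∀ {V V' : VSet n} → (∀ {w} → V w → V' w) →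
                   ∀ {a b} → ConnectedIn G V a b → ConnectedIn G V' a b
  connected-mono V⊆V' = Star.map (λ (Va , Vb , a~b) → V⊆V' Va , V⊆V' Vb , a~b)

  chain⇒connected : ∀ {V m a b} → DescendantsIn V a → Chain G m a b → ConnectedIn G V a b
  chain⇒connected desc-in []            = ε
  chain⇒connected desc-in (e@(a~b , _) ∷ p) =
    (desc-in [] , desc-in (e ∷ []) , a~b) ◅ chain⇒connected (desc-in ∘ (e ∷_)) p

  record RootCover (U : VSet n) (budget : ℕ) : Set where
    field
      roots        : List (Fin n)
      classes      : ℕ
      class        : Fin (length roots) → Fin classes
      covered      : ∀ {w} → U w → ∃[ i ] ∃[ m ] Chain G m (lookup roots i) w
      closed       : ∀ i → DescendantsIn U (lookup roots i)
      class-linked : ∀ i j → class i ≡ class j → ConnectedIn G U (lookup roots i) (lookup roots j)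
      within       : length roots + classes ≤ budget

  initial-cover : ∀ {k} (α : Fin n → Fin k) {d} → ∣ α ∣ₘ ≤ d → RootCover (DescSet G α) (2 * d)
  initial-cover α |α|≤d = record
    { roots        = support α
    ; classes      = length (support α)
    ; class        = λ i → i
    ; covered      = covered
    ; closed       = λ i p → lookup (support α) i , ∈-support⁻ α (∈-lookup i) , chain⇒Desc G p
    ; class-linked = λ { i j refl → ε }
    ; within       = +-mono-≤ supp≤d (≤-trans supp≤d (≤-reflexive (sym (+-identityʳ _))))
    }
    where
      supp≤d = ≤-trans (length-support≤ α) |α|≤d

      covered : ∀ {w} → DescSet G α w → ∃[ i ] ∃[ m ] Chain G m (lookup (support α) i) w
      covered (s , s∈supp , s⇝w) with ∈-support⁺ α s∈supp | Desc⇒chain G s⇝w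
      ... | s∈ | m , p = Any.index s∈ , m , subst (λ r → Chain G m r _) (lookup-index s∈) p

  common-ancestor : ∀ {u* v*} → u* ≡ v* ⊎ Adj G u* v* →
                    ∃[ x ] (x ≡ u* ⊎ x ≡ v*) × (∃[ m ] Chain G m x u*) × (∃[ m ] Chain G m x v*)
  common-ancestor (inj₁ refl) = _ , inj₁ refl , (0 , []) , (0 , [])
  common-ancestor {u*} {v*} (inj₂ u*~v*) with <-cmp (toℕ u*) (toℕ v*)
  ... | tri< u*<v* _ _ = u* , inj₁ refl , (0 , []) , (1 , (u*~v* , u*<v*) ∷ [])
  ... | tri≈ _ u*≡v* _ = ⊥-elim (adj-irrefl G (subst (Adj G u*) (sym (toℕ-injective u*≡v*)) u*~v*))
  ... | tri> _ _ v*<u* = v* , inj₂ refl , (1 , (adj-sym G u*~v* , v*<u*) ∷ []) , (0 , [])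

  module Merge {U : VSet n} {b : ℕ} {u* v* : Fin n} (C : RootCover U b) where

    open RootCover C using (roots; covered; closed)

    U' : VSet n
    U' w = U w ⊎ Desc G u* w ⊎ Desc G v* w

    root : Fin (length roots) → Fin n
    root = lookup roots

    module _ {c} (class : Fin (length roots) → Fin (suc c))
             (linked : ∀ i j → class i ≡ class j → ConnectedIn G U (root i) (root j))
             (within : length roots + suc c ≤ b)
             {u v} (u≁v : ¬ ConnectedIn G U u v) (u*-u : Parent G u* u) (v*-v : Parent G v* v)
             {iu iv mu mv} (root⇝u : Chain G mu (root iu) u) (root⇝v : Chain G mv (root iv) v)
             {x mx my} (x-is : x ≡ u* ⊎ x ≡ v*) (x⇝u* : Chain G mx x u*) (x⇝v* : Chain G my x v*) where

      x-desc-in : DescendantsIn U' x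
      x-desc-in p = [ (λ { refl → inj₂ (inj₁ (chain⇒Desc G p)) }) ,
                      (λ { refl → inj₂ (inj₂ (chain⇒Desc G p)) }) ] x-is

      root~ : ∀ {i w m} → Chain G m (root i) w → ConnectedIn G U (root i) w
      root~ = chain⇒connected (closed _)

      linked-via : ∀ {i w mw mx'} → Chain G mw (root i) w → Chain G mx' x w →
                   ∀ j → class j ≡ class i → ConnectedIn G U' x (root j)
      linked-via root⇝w x⇝w j eq =
        chain⇒connected x-desc-in x⇝w ◅◅
        connected-mono inj₁ (connected-sym (root~ root⇝w) ◅◅ linked _ j (sym eq))

      classes-differ : class iu ≢ class iv
      classes-differ eq = u≁v (connected-sym (root~ root⇝u) ◅◅ linked iu iv eq ◅◅ root~ root⇝v)

      open Fuse classes-differ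

      roots' : List (Fin n)
      roots' = x ∷ roots

      old-class : Fin (length roots') → Fin (suc c)
      old-class Fin.zero    = class iu
      old-class (Fin.suc i) = class i

      to-x : ∀ i → InPair (old-class i) → ConnectedIn G U' x (lookup roots' i)
      to-x Fin.zero    _          = ε
      to-x (Fin.suc j) (inj₁ eq) = linked-via root⇝u (x⇝u* ++ (u*-u ∷ [])) j eq
      to-x (Fin.suc j) (inj₂ eq) = linked-via root⇝v (x⇝v* ++ (v*-v ∷ [])) j eq

      via-x : ∀ i j → InPair (old-class i) → InPair (old-class j) →
              ConnectedIn G U' (lookup roots' i) (lookup roots' j)
      via-x i j pi pj = connected-sym (to-x i pi) ◅◅ to-x j pj

      linked' : ∀ i j → fuse (old-class i) ≡ fuse (old-class j) →
                ConnectedIn G U' (lookup roots' i) (lookup roots' j)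
      linked' i j eq with fuse-≡ {old-class i} {old-class j} eq
      ... | inj₂ (pi , pj) = via-x i j pi pj
      linked' (Fin.suc i) (Fin.suc j) _ | inj₁ same = connected-mono inj₁ (linked i j same)
      linked' Fin.zero      j        _ | inj₁ same =
        via-x Fin.zero j (inj₁ refl) (subst InPair same (inj₁ refl))
      linked' i@(Fin.suc _) Fin.zero _ | inj₁ same =
        via-x i Fin.zero (subst InPair (sym same) (inj₁ refl)) (inj₁ refl)

      covered' : ∀ {w} → U' w → ∃[ i ] ∃[ m ] Chain G m (lookup roots' i) w
      covered' (inj₁ Uw) with covered Uw
      ... | i , m , p = Fin.suc i , m , p
      covered' (inj₂ (inj₁ u*⇝w)) = Fin.zero , _ , x⇝u* ++ proj₂ (Desc⇒chain G u*⇝w)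
      covered' (inj₂ (inj₂ v*⇝w)) = Fin.zero , _ , x⇝v* ++ proj₂ (Desc⇒chain G v*⇝w)

      closed' : ∀ i → DescendantsIn U' (lookup roots' i)
      closed' Fin.zero    = x-desc-in
      closed' (Fin.suc i) = inj₁ ∘ closed i

      merged : RootCover U' b
      merged = record
        { roots        = roots'
        ; classes      = c
        ; class        = fuse ∘ old-class
        ; covered      = covered'
        ; closed       = closed'
        ; class-linked = linked'
        ; within       = subst (_≤ b) (+-suc (length roots) c) within
        }

  merge : ∀ {U b u* v*} → RootCover U b → MergeWitness G U u* v* →
          RootCover (λ w → U w ⊎ Desc G u* w ⊎ Desc G v* w) b
  merge C (u , v , Uu , Uv , u≁v , u*-u , v*-v , u*-v*)
    with RootCover.covered C Uu | RootCover.covered C Uv | common-ancestor u*-v*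
  ... | iu , _ , root⇝u | iv , _ , root⇝v | x , x-is , (_ , x⇝u*) , (_ , x⇝v*)
    with RootCover.classes C | RootCover.class C | RootCover.class-linked C | RootCover.within C
  ... | zero  | class | _      | _      = ⊥-elim (¬Fin0 (class iu))
  ... | suc c | class | linked | within =
    Merge.merged C class linked within u≁v u*-u v*-v root⇝u root⇝v x-is x⇝u* x⇝v*

  run⇒cover : ∀ {k} {α : Fin n → Fin k} {d U} → ∣ α ∣ₘ ≤ d → EssRun G α U → RootCover U (2 * d)
  run⇒cover |α|≤d start             = initial-cover _ |α|≤d
  run⇒cover |α|≤d (step _ _ run mw) = merge (run⇒cover |α|≤d run) mw

module _ {n : ℕ} (G : Graph n) (U : VSet n) where

  AdjAvoiding : Fin n → Fin n → Fin n → Set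
  AdjAvoiding w p q = InducedAdj G U p q × p ≢ w × q ≢ w

  RisingTo : Fin n → Fin n → Fin n → Set
  RisingTo b p q = InducedAdj G U p q × toℕ p < toℕ q × toℕ q ≤ toℕ b

  avoiding-flip : ∀ {w p q} → AdjAvoiding w p q → AdjAvoiding w q p
  avoiding-flip ((Up , Uq , p~q) , p≢w , q≢w) = (Uq , Up , adj-sym G p~q) , q≢w , p≢w

  chain-rising : ∀ {m r b} → DescendantsIn G U r → Chain G m r b → Walk (RisingTo b) m r b
  chain-rising desc-in []                    = []
  chain-rising desc-in (e@(p~q , p<q) ∷ rest) =
    ((desc-in [] , desc-in (e ∷ []) , p~q) , p<q , chain-≤ G rest) ∷ chain-rising (desc-in ∘ (e ∷_)) rest

  rising-avoiding : ∀ {b w p q} → toℕ b < toℕ w → RisingTo b p q → AdjAvoiding w p q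
  rising-avoiding b<w (p~q , p<q , q≤b) =
    p~q , Finₚ.<⇒≢ (<-trans p<q (≤-<-trans q≤b b<w)) , Finₚ.<⇒≢ (≤-<-trans q≤b b<w)

  rising-except : ∀ {w c p q} → toℕ w < toℕ c → RisingTo w p q → AdjExcept G U w c p q
  rising-except w<c (p~q , p<q , q≤w) = p~q , λ
    { (inj₁ (refl , _)) → n≮n _ (<-≤-trans p<q q≤w)
    ; (inj₂ (refl , _)) → n≮n _ (<-trans (<-≤-trans p<q q≤w) w<c) }

  avoiding-except : ∀ {w c p q} → AdjAvoiding w p q → AdjExcept G U w c p q
  avoiding-except (p~q , p≢w , q≢w) = p~q , [ p≢w ∘ proj₁ , q≢w ∘ proj₂ ]

  -- w is the higher of two valley bottoms below a common root r, and c its neighbour off the arc.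
  cycle-through-valleys : ∀ {w c w' r t m m'} → Adj G w c → toℕ w < toℕ c → toℕ w' < toℕ w →
                          Walk (AdjAvoiding w) t c w' → DescendantsIn G U r →
                          Chain G m r w → Chain G m' r w' →
                          ∃[ L ] L ≤ t + (m' + m) × CycleIn G U (suc L)
  cycle-through-valleys w~c w<c w'<w arc desc-in r⇝w r⇝w' =
    closed-walk⇒cycle G w~c
      (map avoiding-except arc ++
       map avoiding-except (reverse avoiding-flip (map (rising-avoiding w'<w) (chain-rising desc-in r⇝w'))) ++
       map (rising-except w<c) (chain-rising desc-in r⇝w))

module Modular (L : ℕ) where

  private
    ℓ : ℕ
    ℓ = suc L

  %-cong-+ʳ : ∀ {x y} z → x % ℓ ≡ y % ℓ → (x + z) % ℓ ≡ (y + z) % ℓ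
  %-cong-+ʳ {x} {y} z eq = begin
    (x + z) % ℓ                ≡⟨ %-distribˡ-+ x z ℓ ⟩
    (x % ℓ + z % ℓ) % ℓ        ≡⟨ cong (λ r → (r + z % ℓ) % ℓ) eq ⟩
    (y % ℓ + z % ℓ) % ℓ        ≡⟨ %-distribˡ-+ y z ℓ ⟨
    (y + z) % ℓ                ∎
    where open ≡-Reasoning

  %-cancel-+ˡ : ∀ c {a b} → (c + a) % ℓ ≡ (c + b) % ℓ → a % ℓ ≡ b % ℓ
  %-cancel-+ˡ c {a} {b} eq = begin
    a % ℓ                      ≡⟨ [m+kn]%n≡m%n a c ℓ ⟨
    (a + c * ℓ) % ℓ            ≡⟨ cong (_% ℓ) (shift a c L) ⟩
    (c + a + c * L) % ℓ        ≡⟨ %-cong-+ʳ {c + a} {c + b} (c * L) eq ⟩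
    (c + b + c * L) % ℓ        ≡⟨ cong (_% ℓ) (shift b c L) ⟨
    (b + c * ℓ) % ℓ            ≡⟨ [m+kn]%n≡m%n b c ℓ ⟩
    b % ℓ                      ∎
    where
      open ≡-Reasoning
      shift : ∀ x c L → x + c * suc L ≡ c + x + c * L
      shift = solve-∀

  %-window : ∀ a {d} → 0 < d → d < ℓ → (a + d) % ℓ ≢ a % ℓ
  %-window a {d} 0<d d<ℓ eq = <⇒≢ 0<d (sym d≡0)
    where
      open ≡-Reasoning
      d≡0 : d ≡ 0
      d≡0 = begin
        d        ≡⟨ m<n⇒m%n≡m d<ℓ ⟨
        d % ℓ    ≡⟨ %-cancel-+ˡ a (trans eq (cong (_% ℓ) (sym (+-identityʳ a)))) ⟩
        0 % ℓ    ≡⟨⟩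
        0        ∎

  suc-%-reduce : ∀ i → suc i % ℓ ≡ suc (i % ℓ) % ℓ
  suc-%-reduce i =
    trans (cong (λ z → suc z % ℓ) (m≡m%n+[m/n]*n i ℓ)) ([m+kn]%n≡m%n (suc (i % ℓ)) (i / ℓ) ℓ)

  suc-% : ∀ i → (suc (i % ℓ) ≡ suc i % ℓ) ⊎ (suc (i % ℓ) ≡ ℓ × suc i % ℓ ≡ 0)
  suc-% i with m≤n⇒m<n∨m≡n (m%n<n i ℓ)
  ... | inj₁ 1+r<ℓ = inj₁ (trans (sym (m<n⇒m%n≡m 1+r<ℓ)) (sym (suc-%-reduce i)))
  ... | inj₂ 1+r≡ℓ = inj₂ (1+r≡ℓ , trans (suc-%-reduce i) (trans (cong (_% ℓ) 1+r≡ℓ) (n%n≡0 ℓ)))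

module _ {n : ℕ} (G : Graph n) (U : VSet n) where

  record PeriodicWalk (ℓ : ℕ) : Set where
    field
      at          : ℕ → Fin n
      at-in       : ∀ i → U (at i)
      at-adj      : ∀ i → Adj G (at i) (at (suc i))
      at-periodic : ∀ i → at (i + ℓ) ≡ at i
      at-window   : ∀ {i j} → i < j → j < i + ℓ → at j ≢ at i

  cycle⇒periodicWalk : ∀ {ℓ} → CycleIn G U ℓ → PeriodicWalk ℓ
  cycle⇒periodicWalk {suc L} (_ , f , f-injective , f-in , f-adj) = record
    { at          = f ∘ pos
    ; at-in       = f-in ∘ pos
    ; at-adj      = λ i → f-adj (pos i) (pos (suc i)) (pos-next i)
    ; at-periodic = λ i → cong f (pos-mod {i + suc L} {i} ([m+n]%n≡m%n i (suc L)))
    ; at-window   = window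
    }
    where
      open Modular L

      pos : ℕ → Fin (suc L)
      pos i = Fin.fromℕ< (m%n<n i (suc L))

      pos-mod : ∀ {i j} → i % suc L ≡ j % suc L → pos i ≡ pos j
      pos-mod eq = toℕ-injective (trans (toℕ-fromℕ< _) (trans eq (sym (toℕ-fromℕ< _))))

      pos-next : ∀ i → CycSucc (pos i) (pos (suc i))
      pos-next i rewrite toℕ-fromℕ< (m%n<n i (suc L)) | toℕ-fromℕ< (m%n<n (suc i) (suc L)) = suc-% i

      window : ∀ {i j} → i < j → j < i + suc L → f (pos j) ≢ f (pos i)
      window {i} {j} i<j j<i+ℓ eq =
        %-window i (m<n⇒0<n∸m i<j) (m<n+o⇒m∸n<o j i j<i+ℓ)
          (trans (cong (_% suc L) (m+[n∸m]≡n (<⇒≤ i<j)))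
            (trans (sym (toℕ-fromℕ< _)) (trans (cong toℕ (f-injective eq)) (toℕ-fromℕ< _))))

half-plus-two-paths : ∀ {ℓ D k m m'} → 2 * D ≤ ℓ → 2 * (2 * k) < ℓ → m ≤ k → m' ≤ k → D + (m + m') < ℓ
half-plus-two-paths {ℓ} {D} {k} {m} {m'} 2D≤ℓ 4k<ℓ m≤k m'≤k =
  ≤-<-trans (+-monoʳ-≤ D paths≤2k) (*-cancelˡ-< 2 (D + 2 * k) ℓ doubled)
  where
    open ≤-Reasoning
    paths≤2k : m + m' ≤ 2 * k
    paths≤2k = +-mono-≤ m≤k (≤-trans m'≤k (m≤m+n k 0))

    doubled : 2 * (D + 2 * k) < 2 * ℓ
    doubled = begin-strict
      2 * (D + 2 * k)        ≡⟨ *-distribˡ-+ 2 D (2 * k) ⟩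
      2 * D + 2 * (2 * k)    <⟨ +-mono-≤-< 2D≤ℓ 4k<ℓ ⟩
      ℓ + ℓ                  ≡⟨ cong (ℓ +_) (+-identityʳ ℓ) ⟨
      2 * ℓ                  ∎

complement-half : ∀ {ℓ D D'} → D + D' ≡ ℓ → ¬ 2 * D ≤ ℓ → 2 * D' ≤ ℓ
complement-half {ℓ} {D} {D'} D+D'≡ℓ 2D≰ℓ = begin
  D' + (D' + 0)  ≡⟨ cong (D' +_) (+-identityʳ D') ⟩
  D' + D'        ≤⟨ +-monoˡ-≤ D' (<⇒≤ D'<D) ⟩
  D + D'         ≡⟨ D+D'≡ℓ ⟩
  ℓ              ∎
  where
    open ≤-Reasoning
    D'<D : D' < D
    D'<D = +-cancelˡ-< D D' D (begin-strict
      D + D'         ≡⟨ D+D'≡ℓ ⟩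
      ℓ              <⟨ ≰⇒> 2D≰ℓ ⟩
      D + (D + 0)    ≡⟨ cong (D +_) (+-identityʳ D) ⟩
      D + D          ∎)

gap-sum : ∀ x a b → x + (suc a + suc b) ≡ suc (suc x + a) + b
gap-sum = solve-∀

2[1+a]≤n⇒1+a<n : ∀ {ℓ a} → 2 * suc a ≤ ℓ → suc a < ℓ
2[1+a]≤n⇒1+a<n 2D≤ℓ = <-≤-trans (m<m+n _ z<s) 2D≤ℓ

first-within : ∀ {P Q : ℕ → Set} → (∀ i → P i ⊎ Q i) → ∀ k → ¬ (∀ j → j ≤ k → Q j) →
               ∃[ s ] s ≤ k × P s × (∀ j → j < s → Q j)
first-within P⊎Q k ¬Q* with P⊎Q 0
... | inj₁ p₀ = 0 , z≤n , p₀ , λ _ ()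
first-within P⊎Q zero    ¬Q* | inj₂ q₀ = ⊥-elim (¬Q* λ { zero _ → q₀ })
first-within P⊎Q (suc k) ¬Q* | inj₂ q₀
  with first-within (P⊎Q ∘ suc) k (λ Q* → ¬Q* λ { zero _ → q₀ ; (suc j) (s≤s j≤k) → Q* j j≤k })
... | s , s≤k , pₛ , Q<s = suc s , s≤s s≤k , pₛ , λ { zero _ → q₀ ; (suc j) (s≤s j<s) → Q<s j j<s }

module _ {n : ℕ} {G : Graph n} {U : VSet n} {ℓ : ℕ} (P : PeriodicWalk G U ℓ) where

  open PeriodicWalk P

  along : ∀ {R : Fin n → Fin n → Set} N t → (∀ j → j < t → R (at (N + j)) (at (suc (N + j)))) →
          Walk R t (at N) (at (N + t))
  along {R} N zero    _ = subst (λ z → Walk R 0 (at N) (at z)) (sym (+-identityʳ N)) []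
  along {R} N (suc t) e =
    subst₂ (λ m z → Walk R m (at N) (at z)) (+-comm t 1) (sym (+-suc N t))
      (along N t (λ j j<t → e j (m<n⇒m<1+n j<t)) ++ (e t ≤-refl ∷ []))

  Up Down : ℕ → Set
  Up   i = toℕ (at i) < toℕ (at (suc i))
  Down i = toℕ (at (suc i)) < toℕ (at i)

  up-or-down : ∀ i → Up i ⊎ Down i
  up-or-down i with <-cmp (toℕ (at i)) (toℕ (at (suc i)))
  ... | tri< up _ _   = inj₁ up
  ... | tri≈ _ same _ = ⊥-elim (adj-irrefl G (subst (Adj G (at i)) (sym (toℕ-injective same)) (at-adj i)))
  ... | tri> _ _ down = inj₂ down

  -- The bottom of the valley is at (suc x).
  Valley : ℕ → Set
  Valley x = Down x × Up (suc x)

  valley-periodic : ∀ {x} → Valley x → Valley (x + ℓ)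
  valley-periodic {x} (down , up) =
    subst₂ (λ p q → toℕ p < toℕ q) (sym (at-periodic (suc x))) (sym (at-periodic x)) down ,
    subst₂ (λ p q → toℕ p < toℕ q) (sym (at-periodic (suc x))) (sym (at-periodic (suc (suc x)))) up

  ascent : ∀ N t → (∀ j → j < t → Up (N + j)) → Chain G t (at N) (at (N + t))
  ascent N t ups = along N t (λ j j<t → at-adj (N + j) , ups j j<t)

  descent : ∀ N t → (∀ j → j < t → Down (N + j)) → Chain G t (at (N + t)) (at N)
  descent N t downs =
    reverse (λ e → e) (along {λ p q → Parent G q p} N t (λ j j<t → adj-sym G (at-adj (N + j)) , downs j j<t))

  module _ {k : ℕ} (bounded : PathsBounded G k) where

    no-long-ascent : ∀ N → ¬ (∀ j → j ≤ k → Up (N + j))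
    no-long-ascent N ups =
      n≮n k (chain-length≤ G bounded (ascent N (suc k) (λ j j<1+k → ups j (≤-pred j<1+k))))

    no-long-descent : ∀ N → ¬ (∀ j → j ≤ k → Down (N + j))
    no-long-descent N downs =
      n≮n k (chain-length≤ G bounded (descent N (suc k) (λ j j<1+k → downs j (≤-pred j<1+k))))

    valley-after-descent : ∀ N → Down N → ∃[ t ] t < k × Valley (N + t)
    valley-after-descent N down with first-within (up-or-down ∘ (N +_)) k (no-long-descent N)
    ... | zero  , _     , up , _     = ⊥-elim (<-asym (subst Up (+-identityʳ N) up) down)
    ... | suc t , 1+t≤k , up , downs = t , 1+t≤k , downs t ≤-refl , subst Up (+-suc N t) up

    valley-within : ∀ N → ∃[ t ] t < 2 * k × Valley (N + t)
    valley-within N with up-or-down N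
    ... | inj₂ down = let t , t<k , valley = valley-after-descent N down
                      in t , ≤-trans t<k (m≤m+n k (k + 0)) , valley
    ... | inj₁ up with first-within (swap ∘ up-or-down ∘ (N +_)) k (no-long-ascent N)
    ...   | zero  , _     , down , _ = ⊥-elim (<-asym up (subst Down (+-identityʳ N) down))
    ...   | suc s , 1+s≤k , down , _ with valley-after-descent (N + suc s) down
    ...     | t , t<k , valley =
      suc s + t , +-mono-≤-< 1+s≤k (≤-trans t<k (≤-reflexive (sym (+-identityʳ k)))) ,
      subst Valley (+-assoc N (suc s) t) valley

  arc-after : ∀ P a → suc a < ℓ → Walk (AdjAvoiding G U (at P)) a (at (suc P)) (at (suc P + a))
  arc-after P a 1+a<ℓ = along (suc P) a edge
    where
      far : ∀ j → j ≤ a → at (suc P + j) ≢ at P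
      far j j≤a = at-window (s≤s (m≤m+n P j))
        (≤-<-trans (≤-reflexive (sym (+-suc P j))) (+-monoʳ-< P (≤-<-trans (s≤s j≤a) 1+a<ℓ)))

      edge : ∀ j → j < a → AdjAvoiding G U (at P) (at (suc P + j)) (at (suc (suc P + j)))
      edge j j<a = (at-in _ , at-in _ , at-adj _) , far j (<⇒≤ j<a) ,
                   subst (λ i → at i ≢ at P) (+-suc (suc P) j) (far (suc j) j<a)

  arc-before : ∀ P a → suc a < ℓ → Walk (AdjAvoiding G U (at (suc (P + a)))) a (at (P + a)) (at P)
  arc-before P a 1+a<ℓ = reverse (avoiding-flip G U) (along P a edge)
    where
      far : ∀ j → j ≤ a → at (P + j) ≢ at (suc (P + a))
      far j j≤a eq = at-window (+-monoʳ-< P (s≤s j≤a))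
        (<-≤-trans (+-monoʳ-< P 1+a<ℓ) (+-monoˡ-≤ ℓ (m≤m+n P j))) (trans (cong at (+-suc P a)) (sym eq))

      edge : ∀ j → j < a → AdjAvoiding G U (at (suc (P + a))) (at (P + j)) (at (suc (P + j)))
      edge j j<a = (at-in _ , at-in _ , at-adj _) , far j (<⇒≤ j<a) ,
                   subst (λ i → at i ≢ at (suc (P + a))) (+-suc P j) (far (suc j) j<a)

  close-valleys : ∀ {x a r m m'} → Valley x → Valley (suc x + a) → suc a < ℓ → DescendantsIn G U r →
                  Chain G m r (at (suc x)) → Chain G m' r (at (suc (suc x + a))) →
                  ∃[ L ] L ≤ a + (m + m') × CycleIn G U (suc L)
  close-valleys {x} {a} {m = m} {m'} (_ , up) (down , _) 1+a<ℓ desc-in r⇝P r⇝Q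
    with <-cmp (toℕ (at (suc x))) (toℕ (at (suc (suc x + a))))
  ... | tri≈ _ same _ =
    ⊥-elim (at-window (s≤s (s≤s (m≤m+n x a))) (s≤s (subst (_< x + ℓ) (+-suc x a) (+-monoʳ-< x 1+a<ℓ)))
                      (sym (toℕ-injective same)))
  ... | tri< P<Q _ _ =
    cycle-through-valleys G U (adj-sym G (at-adj (suc x + a))) down P<Q (arc-before (suc x) a 1+a<ℓ)
      desc-in r⇝Q r⇝P
  ... | tri> _ _ Q<P
    with cycle-through-valleys G U (at-adj (suc x)) up Q<P (arc-after (suc x) a 1+a<ℓ) desc-in r⇝P r⇝Q
  ...   | L , L≤ , cycle = L , subst (L ≤_) (cong (a +_) (+-comm m' m)) L≤ , cycle

  short-cycle : ∀ {k x a r m m'} → 2 * (2 * k) < ℓ → m ≤ k → m' ≤ k → 2 * suc a ≤ ℓ →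
                Valley x → Valley (suc x + a) → DescendantsIn G U r →
                Chain G m r (at (suc x)) → Chain G m' r (at (suc (suc x + a))) →
                ∃[ L ] L < ℓ × CycleIn G U L
  short-cycle 4k<ℓ m≤k m'≤k 2D≤ℓ vx vy desc-in r⇝x r⇝y
    with close-valleys vx vy (2[1+a]≤n⇒1+a<n 2D≤ℓ) desc-in r⇝x r⇝y
  ... | L , L≤ , cycle = suc L , ≤-<-trans (s≤s L≤) (half-plus-two-paths 2D≤ℓ 4k<ℓ m≤k m'≤k) , cycle

  short-cycle-around : ∀ {k x y b r m m'} → 2 * (2 * k) < ℓ → m ≤ k → m' ≤ k → 2 * suc b ≤ ℓ →
                       suc y + b ≡ x + ℓ → Valley x → Valley y → DescendantsIn G U r →
                       Chain G m r (at (suc x)) → Chain G m' r (at (suc y)) →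
                       ∃[ L ] L < ℓ × CycleIn G U L
  short-cycle-around {x = x} {r = r} {m = m} 4k<ℓ m≤k m'≤k 2D≤ℓ y+D≡x+ℓ vx vy desc-in r⇝x r⇝y =
    short-cycle 4k<ℓ m'≤k m≤k 2D≤ℓ vy (subst Valley (sym y+D≡x+ℓ) (valley-periodic vx)) desc-in r⇝y
      (subst (λ z → Chain G m r (at (suc z))) (sym y+D≡x+ℓ) r⇝x+ℓ)
    where
      r⇝x+ℓ : Chain G m r (at (suc x + ℓ))
      r⇝x+ℓ = subst (Chain G m r) (sym (at-periodic (suc x))) r⇝x

  two-valleys : ∀ {k x y r m m'} → 2 * (2 * k) < ℓ → m ≤ k → m' ≤ k →
                Valley x → Valley y → x < y → y < x + ℓ → DescendantsIn G U r →
                Chain G m r (at (suc x)) → Chain G m' r (at (suc y)) →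
                ∃[ L ] L < ℓ × CycleIn G U L
  two-valleys {x = x} 4k<ℓ m≤k m'≤k vx vy x<y y<x+ℓ desc-in r⇝x r⇝y
    with m≤n⇒∃[o]m+o≡n x<y | m≤n⇒∃[o]m+o≡n y<x+ℓ
  ... | a , refl | b , y+1+b≡x+ℓ with 2 * suc a ≤? ℓ
  ...   | yes 2D≤ℓ = short-cycle 4k<ℓ m≤k m'≤k 2D≤ℓ vx vy desc-in r⇝x r⇝y
  ...   | no  2D≰ℓ = short-cycle-around 4k<ℓ m≤k m'≤k 2D'≤ℓ y+1+b≡x+ℓ vx vy desc-in r⇝x r⇝y
    where
      2D'≤ℓ : 2 * suc b ≤ ℓ
      2D'≤ℓ = complement-half {D = suc a} (+-cancelˡ-≡ x _ _ (trans (gap-sum x a b) y+1+b≡x+ℓ)) 2D≰ℓ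

  module _ {k b} (bounded : PathsBounded G k) (C : RootCover G U b) where

    open RootCover C

    private
      offset : ℕ → ℕ
      offset N = proj₁ (valley-within bounded N)

      valley-at : Fin ℓ → ℕ
      valley-at i = toℕ i + offset (toℕ i)

      valley : ∀ i → Valley (valley-at i)
      valley i = proj₂ (proj₂ (valley-within bounded (toℕ i)))

      source : Fin ℓ → Fin (length roots)
      source i = proj₁ (covered (at-in (suc (valley-at i))))

      depth : Fin ℓ → ℕ
      depth i = proj₁ (proj₂ (covered (at-in (suc (valley-at i)))))

      chain : ∀ i → Chain G (depth i) (lookup roots (source i)) (at (suc (valley-at i)))
      chain i = proj₂ (proj₂ (covered (at-in (suc (valley-at i)))))

      tag : Fin ℓ → Fin (2 * k)
      tag i = Fin.fromℕ< (proj₁ (proj₂ (valley-within bounded (toℕ i))))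

      key : Fin ℓ → Fin (length roots * (2 * k))
      key i = Fin.combine (source i) (tag i)

      same-offset : ∀ {i j} → key i ≡ key j → offset (toℕ i) ≡ offset (toℕ j)
      same-offset {i} {j} eq = trans (sym (toℕ-fromℕ< _))
        (trans (cong toℕ (Finₚ.combine-injectiveʳ (source i) (tag i) (source j) (tag j) eq)) (toℕ-fromℕ< _))

      valley-at-< : ∀ {i j} → i Fin.< j → key i ≡ key j → valley-at i < valley-at j
      valley-at-< {i} {j} i<j eq =
        subst (valley-at i <_) (cong (toℕ j +_) (same-offset eq)) (+-monoˡ-< (offset (toℕ i)) i<j)

      valley-at-window : ∀ i j → key i ≡ key j → valley-at j < valley-at i + ℓ
      valley-at-window i j eq = begin-strict
        toℕ j + offset (toℕ j)   ≡⟨ cong (toℕ j +_) (same-offset eq) ⟨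
        toℕ j + o                <⟨ +-monoˡ-< o (toℕ<n j) ⟩
        ℓ + o                    ≡⟨ +-comm ℓ o ⟩
        o + ℓ                    ≤⟨ +-monoˡ-≤ ℓ (m≤n+m o (toℕ i)) ⟩
        toℕ i + o + ℓ            ∎
        where
          open ≤-Reasoning
          o = offset (toℕ i)

    -- Position i is keyed by a root above the first valley bottom after it and by its offset to it;
    -- equal keys give bottoms that lie less than one period apart, hence are distinct.
    shorter-cycle : length roots * (2 * k) < ℓ → 2 * (2 * k) < ℓ → ∃[ L ] L < ℓ × CycleIn G U L
    shorter-cycle pigeon 4k<ℓ with Finₚ.pigeonhole pigeon key
    ... | i , j , i<j , same-key =
      two-valleys 4k<ℓ (depth≤ i) (depth≤ j) (valley i) (valley j)
        (valley-at-< i<j same-key) (valley-at-window i j same-key) (closed (source i)) (chain i)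
        (subst (λ r → Chain G (depth j) (lookup roots r) (at (suc (valley-at j)))) (sym same-source) (chain j))
      where
        depth≤ : ∀ i → depth i ≤ k
        depth≤ i = chain-length≤ G bounded (chain i)

        same-source : source i ≡ source j
        same-source = Finₚ.combine-injectiveˡ (source i) (tag i) (source j) (tag j) same-key

pigeonhole-room : ∀ {k R ℓ} → 2 * k * suc R < ℓ → R * (2 * k) < ℓ
pigeonhole-room {k} {R} {ℓ} bound =
  ≤-<-trans (≤-trans (≤-reflexive (*-comm R (2 * k))) (m≤n+m _ (2 * k)))
            (subst (_< ℓ) (*-suc (2 * k) R) bound)

two-paths-room : ∀ {k R ℓ} → 0 < R → 2 * k * suc R < ℓ → 2 * (2 * k) < ℓ
two-paths-room {k} 0<R bound =
  ≤-<-trans (≤-trans (≤-reflexive (*-comm 2 (2 * k))) (*-monoʳ-≤ (2 * k) (s≤s 0<R))) bound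

cycle-in-full : ∀ {n} {G : Graph n} {U ℓ} → CycleIn G U ℓ → Cycle G ℓ
cycle-in-full (3≤ℓ , f , f-injective , _ , f-adj) = 3≤ℓ , f , f-injective , (λ _ → tt) , f-adj

cover⇒forest : ∀ {n k b g} {G : Graph n} {U : VSet n} → PathsBounded G k → (C : RootCover G U b) →
                 (∀ ℓ → ℓ < g → ¬ Cycle G ℓ) → 2 * k * suc (length (RootCover.roots C)) < g →
                 IsForest G U
cover⇒forest {k = k} {g = g} {G = G} {U} bounded C no-short-cycle bound =
  <-rec (λ ℓ → ¬ CycleIn G U ℓ) minimal
  where
    open RootCover C

    shortens : ∀ {ℓ} → g ≤ ℓ → CycleIn G U ℓ → ∃[ L ] L < ℓ × CycleIn G U L
    shortens g≤ℓ cycle =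
      shorter-cycle P bounded C (pigeonhole-room {k} bound') (two-paths-room {k} nonempty bound')
      where
        P = cycle⇒periodicWalk G U cycle
        bound' = <-≤-trans bound g≤ℓ

        nonempty : 0 < length roots
        nonempty = ≤-<-trans z≤n (toℕ<n (proj₁ (covered (PeriodicWalk.at-in P 0))))

    minimal : ∀ ℓ → (∀ {L} → L < ℓ → ¬ CycleIn G U L) → ¬ CycleIn G U ℓ
    minimal ℓ no-shorter cycle with ℓ <? g
    ... | yes ℓ<g = no-short-cycle ℓ ℓ<g (cycle-in-full {G = G} {U} cycle)
    ... | no  ℓ≮g = let L , L<ℓ , shorter = shortens (≮⇒≥ ℓ≮g) cycle in no-shorter L<ℓ shorter

corollary4p8 :
    (k : ℕ) → 3 ≤ k → (n : ℕ) → (G : Graph n) → (g : ℕ) →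
    ChromaticNumber G (k + 1) → Girth G g → PathsBounded G k →
    (d : ℕ) → 2 * k * (2 * d + 1) < g →
    (α : Fin n → Fin k) → ∣ α ∣ₘ ≤ d →
    (U : VSet n) → IsEssential G α U → IsForest G U
corollary4p8 k _ n G g _ (_ , no-short-cycle) bounded d bound α |α|≤d U (run , _) =
  cover⇒forest bounded C no-short-cycle (≤-<-trans (*-monoʳ-≤ (2 * k) roots≤) bound)
  where
    C = run⇒cover G |α|≤d run

    roots≤ : suc (length (RootCover.roots C)) ≤ 2 * d + 1
    roots≤ = subst (suc (length roots) ≤_) (+-comm 1 (2 * d)) (s≤s (≤-trans (m≤m+n _ _) within))
      where open RootCover C
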